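{- If $E$ and $F$ are oriented $d$-primitive segments satisfying $W_{d}(E) = \pm W_{d}(F)$, then $E$ and $F$ are $G$-equivalent. Moreover, if $p$ is an endpoint of $E$ and $p'$ an endpoint of $F$, a $G$-equivalence may be chosen that sends $p$ to $p'$.
   Context: $G = GL_2(\mathbb{Z}) \rtimes \mathbb{Z}^2$ acts on $\mathbb{R}^2$ by $x\mapsto Ux+v$; two regions are $G$-equivalent if one is the image of the other under such a map. Let $\mathcal{L}_d = \frac{1}{d}\mathbb{Z}\times\frac{1}{d}\mathbb{Z}$. A segment with endpoints in $\mathcal{L}_d$ is $d$-minimal if it meets $\mathcal{L}_d$ only in its endpoints. For an oriented $d$-minimal segment $E$ from $(w/d,x/d)$ to $(y/d,z/d)$, its weight is $W_d(E) = \det\begin{pmatrix} w & y\\ x & z\end{pmatrix} \bmod d$. An oriented segment is $d$-primitive if it is $d$-minimal and $W_d(E)$ is a unit in $\mathbb{Z}/d\mathbb{Z}$. -}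

module Defs where

open import Data.Nat using (ℕ; NonZero) renaming (_<_ to _<ℕ_)
open import Data.Integer using (ℤ; +_; _+_; _-_; _*_; -_; 1ℤ; 0ℤ)
open import Data.Integer.Divisibility using (_∣_)
open import Data.Product using (_×_; _,_; ∃; Σ)
open import Data.Sum using (_⊎_)
open import Relation.Binary.PropositionalEquality using (_≡_)
open import Relation.Nullary using (¬_)

-- A point of L_d = (1/d)ℤ × (1/d)ℤ is recorded by its numerators:
-- the pair (w , x) stands for the point (w/d , x/d) of ℝ².
Pt : Set
Pt = ℤ × ℤ

record Seg : Set where
  constructor seg
  field
    start : Pt
    end   : Pt
    nondeg : ¬ (start ≡ end)
open Seg public

-- c (a point of L_d, in numerators) lies on the segment strictly between a and b:
-- c = a + t (b - a) for a rational t = m / n with 0 < m < n.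
StrictlyBetween : Pt → Pt → Pt → Set
StrictlyBetween (a₁ , a₂) (b₁ , b₂) (c₁ , c₂) =
  ∃ λ (m : ℕ) → ∃ λ (n : ℕ) → (0 <ℕ m) × (m <ℕ n) ×
    ((+ n) * c₁ ≡ (+ n) * a₁ + (+ m) * (b₁ - a₁)) ×
    ((+ n) * c₂ ≡ (+ n) * a₂ + (+ m) * (b₂ - a₂))

Minimal : Seg → Set
Minimal E = ∀ (c : Pt) → ¬ StrictlyBetween (start E) (end E) c

-- Integer representative of the weight W_d(E) = det [[w, y], [x, z]] mod d.
det : Seg → ℤ
det E with start E | end E
... | (w , x) | (y , z) = w * z - y * x

CongMod : ℕ → ℤ → ℤ → Set
CongMod d a b = (+ d) ∣ (a - b)

UnitMod : ℕ → ℤ → Set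
UnitMod d a = ∃ λ (u : ℤ) → CongMod d (a * u) 1ℤ

Primitive : ℕ → Seg → Set
Primitive d E = Minimal E × UnitMod d (det E)

record Mat : Set where
  constructor mat
  field
    m11 m12 m21 m22 : ℤ
open Mat public

_·_ : Mat → Mat → Mat
mat a b c e · mat a' b' c' e' =
  mat (a * a' + b * c') (a * b' + b * e') (c * a' + e * c') (c * b' + e * e')

I₂ : Mat
I₂ = mat 1ℤ 0ℤ 0ℤ 1ℤ

InGL2 : Mat → Set
InGL2 U = ∃ λ V → (U · V ≡ I₂) × (V · U ≡ I₂)

record G : Set where
  constructor aff
  field
    U    : Mat
    isGL : InGL2 U
    v    : ℤ × ℤ
open G public

-- Action of G on ℝ² restricted to L_d, in numerator coordinates:
-- (w/d, x/d) ↦ U (w/d, x/d) + v = ((U(w,x) + d v)/d).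
act : ℕ → G → Pt → Pt
act d (aff (mat a b c e) _ (v₁ , v₂)) (w , x) =
  (a * w + b * x + (+ d) * v₁ , c * w + e * x + (+ d) * v₂)

-- An affine bijection maps the segment [p,q] onto [g p, g q], and a segment
-- determines its endpoint set, so this holds iff g maps endpoints to endpoints.
MapsOnto : ℕ → G → Seg → Seg → Set
MapsOnto d g E F =
  ((act d g (start E) ≡ start F) × (act d g (end E) ≡ end F)) ⊎
  ((act d g (start E) ≡ end F) × (act d g (end E) ≡ start F))

IsEndpoint : Pt → Seg → Set
IsEndpoint p E = (p ≡ start E) ⊎ (p ≡ end E)

module Submission where

-- 1. G is a group acting on L_d: elements compose and have inverses
--    (matrix algebra; GL₂(ℤ) membership follows from determinant ±1).
-- 2. A d-minimal segment from p to q has primitive direction q - p: a common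
--    divisor k ≥ 2 of its coordinates would put the lattice point
--    p + (q - p)/k strictly inside.  Bézout then gives a, b with
--    a (q₁ - p₁) + b (q₂ - p₂) = 1.
-- 3. Normal form: the matrix [[a, b], [q₂ - p₂, p₁ - q₁]] (determinant -1)
--    sends p, q to the horizontal unit step (A , W), (A + 1 , W), where W is
--    the weight representative det E.
-- 4. Shear: if W is a unit mod d and s W ≡ W' (mod d) for a sign s, an
--    upper-triangular element [[t, K], [0, s]] with translation moves the step
--    at height W onto any step at height W', in direction t = ±1.
-- 5. Composing normal form of E, shear, and inverse normal form of F gives
--    an orientation-preserving and an orientation-reversing equivalence E → F;
--    choosing between them realises any prescribed endpoint correspondence.

open import Defs
open import Data.Nat using (ℕ; NonZero; zero; suc; s≤s; z≤n)
import Data.Nat as ℕ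
open import Data.Nat.Coprimality using (Coprime; coprime-Bézout)
open import Data.Nat.GCD using (module Bézout)
open import Data.Integer using (ℤ; +_; -_; _+_; _-_; _*_; 0ℤ; 1ℤ; ∣_∣)
open import Data.Integer.Properties
  using (pos-+; pos-*; +∣i∣≡i⊎+∣i∣≡-i; *-identityˡ; -1*i≡-i; i-j≡0⇒i≡j;
         +-comm; +-assoc; +-identityˡ; +-identityʳ; *-zeroˡ; *-zeroʳ)
open import Data.Integer.Divisibility.Signed using (divides; ∣ᵤ⇒∣; 0∣⇒≡0)
open import Data.Integer.Tactic.RingSolver using (solve)
open import Data.List using (_∷_; [])
open import Data.Empty using (⊥-elim)
open import Data.Product using (_×_; _,_; ∃; ∃₂; proj₁; proj₂)
open import Data.Sum using (_⊎_; inj₁; inj₂)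
import Data.Sum as Sum
open import Relation.Binary.PropositionalEquality
  using (_≡_; refl; sym; trans; cong; cong₂; subst₂; module ≡-Reasoning)

open ≡-Reasoning

cong-mat : ∀ {a b c e a' b' c' e'} →
  a ≡ a' → b ≡ b' → c ≡ c' → e ≡ e' → mat a b c e ≡ mat a' b' c' e'
cong-mat refl refl refl refl = refl

·-assoc : ∀ A B C → (A · B) · C ≡ A · (B · C)
·-assoc (mat a b c e) (mat a' b' c' e') (mat a'' b'' c'' e'') =
  cong-mat (entry a b a'' c'') (entry a b b'' e'') (entry c e a'' c'') (entry c e b'' e'')
  where
  entry : ∀ x y z w → (x * a' + y * c') * z + (x * b' + y * e') * w
                    ≡ x * (a' * z + b' * w) + y * (c' * z + e' * w)
  entry x y z w = solve (x ∷ y ∷ z ∷ w ∷ a' ∷ b' ∷ c' ∷ e' ∷ [])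

·-identityˡ : ∀ A → I₂ · A ≡ A
·-identityˡ (mat a b c e) = cong-mat (left a c) (left b e) (right a c) (right b e)
  where
  left : ∀ x y → 1ℤ * x + 0ℤ * y ≡ x
  left x y = solve (x ∷ y ∷ [])
  right : ∀ x y → 0ℤ * x + 1ℤ * y ≡ y
  right x y = solve (x ∷ y ∷ [])

GL-· : ∀ {A B} → InGL2 A → InGL2 B → InGL2 (A · B)
GL-· {A} {B} (A⁻¹ , AA⁻¹ , A⁻¹A) (B⁻¹ , BB⁻¹ , B⁻¹B) =
  B⁻¹ · A⁻¹ , cancel A B B⁻¹ A⁻¹ BB⁻¹ AA⁻¹ , cancel B⁻¹ A⁻¹ A B A⁻¹A B⁻¹B
  where
  cancel : ∀ X Y Y' X' → Y · Y' ≡ I₂ → X · X' ≡ I₂ → (X · Y) · (Y' · X') ≡ I₂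
  cancel X Y Y' X' YY' XX' = begin
    (X · Y) · (Y' · X')  ≡⟨ ·-assoc X Y (Y' · X') ⟩
    X · (Y · (Y' · X'))  ≡⟨ cong (X ·_) (sym (·-assoc Y Y' X')) ⟩
    X · ((Y · Y') · X')  ≡⟨ cong (λ Z → X · (Z · X')) YY' ⟩
    X · (I₂ · X')        ≡⟨ cong (X ·_) (·-identityˡ X') ⟩
    X · X'               ≡⟨ XX' ⟩
    I₂                   ∎

detᴹ : Mat → ℤ
detᴹ (mat a b c e) = a * e - b * c

-- A matrix of determinant ε = ±1 is invertible, with inverse ε · adj(U).
unimodular⇒GL : ∀ U ε → ε * ε ≡ 1ℤ → detᴹ U ≡ ε → InGL2 U
unimodular⇒GL (mat a b c e) ε εε det≡ε =
  mat (ε * e) (- (ε * b)) (- (ε * c)) (ε * a) ,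
  cong-mat (via-det (solve (a ∷ b ∷ c ∷ e ∷ ε ∷ []))) (solve (a ∷ b ∷ ε ∷ []))
           (solve (c ∷ e ∷ ε ∷ [])) (via-det (solve (a ∷ b ∷ c ∷ e ∷ ε ∷ []))) ,
  cong-mat (via-det (solve (a ∷ b ∷ c ∷ e ∷ ε ∷ []))) (solve (b ∷ e ∷ ε ∷ []))
           (solve (a ∷ c ∷ ε ∷ [])) (via-det (solve (a ∷ b ∷ c ∷ e ∷ ε ∷ [])))
  where
  -- the diagonal entries of U · ε adj(U) and ε adj(U) · U are ε det U = ε ε = 1
  via-det : ∀ {x} → x ≡ ε * (a * e - b * c) → x ≡ 1ℤ
  via-det eq = trans eq (trans (cong (ε *_) det≡ε) εε)

_∘ᴳ_ : G → G → G
aff U gl (v₁ , v₂) ∘ᴳ aff U' gl' (w₁ , w₂) =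
  aff (U · U') (GL-· gl gl')
      (m11 U * w₁ + m12 U * w₂ + v₁ , m21 U * w₁ + m22 U * w₂ + v₂)

act-∘ᴳ : ∀ d g h p → act d (g ∘ᴳ h) p ≡ act d g (act d h p)
act-∘ᴳ d (aff (mat a b c e) _ (v₁ , v₂)) (aff (mat a' b' c' e') _ (w₁ , w₂)) (x , y) =
  cong₂ _,_ (row (+ d) a b v₁) (row (+ d) c e v₂)
  where
  row : ∀ D α β v → (α * a' + β * c') * x + (α * b' + β * e') * y + D * (α * w₁ + β * w₂ + v)
                  ≡ α * (a' * x + b' * y + D * w₁) + β * (c' * x + e' * y + D * w₂) + D * v
  row D α β v = solve (D ∷ α ∷ β ∷ v ∷ a' ∷ b' ∷ c' ∷ e' ∷ x ∷ y ∷ w₁ ∷ w₂ ∷ [])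

inverse : G → G
inverse (aff U (V , UV , VU) (v₁ , v₂)) =
  aff V (U , VU , UV) (- (m11 V * v₁ + m12 V * v₂) , - (m21 V * v₁ + m22 V * v₂))

act-inverse : ∀ d g p → act d (inverse g) (act d g p) ≡ p
act-inverse d (aff (mat a b c e) (mat a' b' c' e' , _ , VU) (v₁ , v₂)) (w , x) =
  cong₂ _,_ (trans (row (+ d) a' b' (cong m11 VU) (cong m12 VU)) (solve (w ∷ x ∷ [])))
            (trans (row (+ d) c' e' (cong m21 VU) (cong m22 VU)) (solve (w ∷ x ∷ [])))
  where
  row : ∀ D α β {i j} → α * a + β * c ≡ i → α * b + β * e ≡ j →
        α * (a * w + b * x + D * v₁) + β * (c * w + e * x + D * v₂)
          + D * - (α * v₁ + β * v₂) ≡ i * w + j * x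
  row D α β {i} {j} αU₁ αU₂ = begin
    α * (a * w + b * x + D * v₁) + β * (c * w + e * x + D * v₂) + D * - (α * v₁ + β * v₂)
      ≡⟨ solve (α ∷ β ∷ a ∷ b ∷ c ∷ e ∷ w ∷ x ∷ v₁ ∷ v₂ ∷ D ∷ []) ⟩
    (α * a + β * c) * w + (α * b + β * e) * x
      ≡⟨ cong₂ (λ i j → i * w + j * x) αU₁ αU₂ ⟩
    i * w + j * x ∎

act-through : ∀ d N M N' {p x p'} → act d N p ≡ x → act d M x ≡ act d N' p' →
  act d (inverse N' ∘ᴳ (M ∘ᴳ N)) p ≡ p'
act-through d N M N' {p} {x} {p'} Np≡x Mx≡N'p' = begin
  act d (inverse N' ∘ᴳ (M ∘ᴳ N)) p    ≡⟨ act-∘ᴳ d (inverse N') (M ∘ᴳ N) p ⟩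
  act d (inverse N') (act d (M ∘ᴳ N) p) ≡⟨ cong (act d (inverse N')) (act-∘ᴳ d M N p) ⟩
  act d (inverse N') (act d M (act d N p)) ≡⟨ cong (λ y → act d (inverse N') (act d M y)) Np≡x ⟩
  act d (inverse N') (act d M x)      ≡⟨ cong (act d (inverse N')) Mx≡N'p' ⟩
  act d (inverse N') (act d N' p')    ≡⟨ act-inverse d N' p' ⟩
  p'                                  ∎

_⊛_ : Mat → Pt → Pt
mat a b c e ⊛ (w , x) = (a * w + b * x , c * w + e * x)

act-linear : ∀ d U gl p → act d (aff U gl (0ℤ , 0ℤ)) p ≡ U ⊛ p
act-linear d (mat a b c e) gl (w , x) = cong₂ _,_ (no-shift _) (no-shift _)
  where
  no-shift : ∀ z → z + + d * 0ℤ ≡ z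
  no-shift z = trans (cong (λ w → z + w) (*-zeroʳ (+ d))) (+-identityʳ z)

quotient-of : ∀ {d a b} → CongMod d a b → ∃ λ q → a - b ≡ q * + d
quotient-of {d} {a} {b} a≡b with ∣ᵤ⇒∣ {+ d} {a - b} a≡b
... | divides q eq = q , eq

abs-as-multiple : ∀ i → ∃ λ s → + ∣ i ∣ ≡ s * i
abs-as-multiple i with +∣i∣≡i⊎+∣i∣≡-i i
... | inj₁ eq = 1ℤ , trans eq (sym (*-identityˡ i))
... | inj₂ eq = - 1ℤ , trans eq (sym (-1*i≡-i i))

lift-identity : ∀ m n x y → 1 ℕ.+ y ℕ.* n ≡ x ℕ.* m → + x * + m ≡ 1ℤ + + y * + n
lift-identity m n x y eq = begin
  + x * + m         ≡⟨ sym (pos-* x m) ⟩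
  + (x ℕ.* m)       ≡⟨ cong +_ (sym eq) ⟩
  + (1 ℕ.+ y ℕ.* n) ≡⟨ pos-+ 1 (y ℕ.* n) ⟩
  1ℤ + + (y ℕ.* n)  ≡⟨ cong (λ w → 1ℤ + w) (pos-* y n) ⟩
  1ℤ + + y * + n    ∎

-- A Bézout relation between the absolute values of i and j yields one
-- between i and j, by absorbing their signs into the coefficients.
absolute-bézout : ∀ i j X Y → X * + ∣ i ∣ ≡ 1ℤ + Y * + ∣ j ∣ → ∃₂ λ a b → a * i + b * j ≡ 1ℤ
absolute-bézout i j X Y eq with abs-as-multiple i | abs-as-multiple j
... | s , sᵢ | t , tⱼ = X * s , - (Y * t) , (begin
  X * s * i + - (Y * t) * j      ≡⟨ solve (X ∷ Y ∷ s ∷ t ∷ i ∷ j ∷ []) ⟩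
  X * (s * i) - Y * (t * j)      ≡⟨ cong (_- Y * (t * j)) eq' ⟩
  1ℤ + Y * (t * j) - Y * (t * j) ≡⟨ solve (Y ∷ t ∷ j ∷ []) ⟩
  1ℤ                             ∎)
  where
  eq' : X * (s * i) ≡ 1ℤ + Y * (t * j)
  eq' = subst₂ (λ I J → X * I ≡ 1ℤ + Y * J) sᵢ tⱼ eq

coprime-bézout : ∀ i j → Coprime ∣ i ∣ ∣ j ∣ → ∃₂ λ a b → a * i + b * j ≡ 1ℤ
coprime-bézout i j coprime with coprime-Bézout coprime
... | Bézout.+- x y eq = absolute-bézout i j (+ x) (+ y) (lift-identity ∣ i ∣ ∣ j ∣ x y eq)
... | Bézout.-+ x y eq with absolute-bézout j i (+ y) (+ x) (lift-identity ∣ j ∣ ∣ i ∣ y x eq)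
...   | b , a , ab = a , b , trans (+-comm (a * i) (b * j)) ab

step-between : ∀ k p₁ p₂ q₁ q₂ r₁ r₂ →
  q₁ - p₁ ≡ r₁ * + suc (suc k) → q₂ - p₂ ≡ r₂ * + suc (suc k) →
  StrictlyBetween (p₁ , p₂) (q₁ , q₂) (p₁ + r₁ , p₂ + r₂)
step-between k p₁ p₂ q₁ q₂ r₁ r₂ e₁ e₂ =
  1 , suc (suc k) , s≤s z≤n , s≤s (s≤s z≤n) ,
  coordinate (+ suc (suc k)) p₁ q₁ e₁ , coordinate (+ suc (suc k)) p₂ q₂ e₂
  where
  coordinate : ∀ n p q {r} → q - p ≡ r * n → n * (p + r) ≡ n * p + + 1 * (q - p)
  coordinate n p q {r} eq = begin
    n * (p + r)           ≡⟨ solve (n ∷ p ∷ r ∷ []) ⟩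
    n * p + + 1 * (r * n) ≡⟨ cong (λ z → n * p + + 1 * z) (sym eq) ⟩
    n * p + + 1 * (q - p) ∎

minimal⇒coprime : ∀ {p₁ p₂ q₁ q₂} nd → Minimal (seg (p₁ , p₂) (q₁ , q₂) nd) →
  Coprime ∣ q₁ - p₁ ∣ ∣ q₂ - p₂ ∣
minimal⇒coprime {p₁} {p₂} {q₁} {q₂} nd minimal {zero} (0∣Δ₁ , 0∣Δ₂) =
  ⊥-elim (nd (cong₂ _,_ (sym (i-j≡0⇒i≡j q₁ p₁ (0∣⇒≡0 (∣ᵤ⇒∣ {+ 0} {q₁ - p₁} 0∣Δ₁))))
                        (sym (i-j≡0⇒i≡j q₂ p₂ (0∣⇒≡0 (∣ᵤ⇒∣ {+ 0} {q₂ - p₂} 0∣Δ₂))))))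
minimal⇒coprime nd minimal {suc zero} _ = refl
minimal⇒coprime {p₁} {p₂} {q₁} {q₂} nd minimal {suc (suc k)} (k∣Δ₁ , k∣Δ₂)
  with ∣ᵤ⇒∣ {+ suc (suc k)} {q₁ - p₁} k∣Δ₁ | ∣ᵤ⇒∣ {+ suc (suc k)} {q₂ - p₂} k∣Δ₂
... | divides r₁ e₁ | divides r₂ e₂ = ⊥-elim (minimal _ (step-between k p₁ p₂ q₁ q₂ r₁ r₂ e₁ e₂))

NormalForm : ℕ → Seg → Set
NormalForm d E = ∃₂ λ A N →
  (act d N (start E) ≡ (A , det E)) × (act d N (end E) ≡ (A + 1ℤ , det E))

normal-form : ∀ d E → Minimal E → NormalForm d E
normal-form d (seg (p₁ , p₂) (q₁ , q₂) nd) minimal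
  with coprime-bézout (q₁ - p₁) (q₂ - p₂) (minimal⇒coprime nd minimal)
... | a , b , bézout =
  a * p₁ + b * p₂ , N ,
  trans (act-linear d R gl (p₁ , p₂)) (cong (_ ,_) height) ,
  trans (act-linear d R gl (q₁ , q₂)) (cong₂ _,_ unit-step height')
  where
  R : Mat
  R = mat a b (q₂ - p₂) (- (q₁ - p₁))
  gl : InGL2 R
  gl = unimodular⇒GL R (- 1ℤ) refl (begin
    a * - (q₁ - p₁) - b * (q₂ - p₂)  ≡⟨ solve (a ∷ b ∷ p₁ ∷ p₂ ∷ q₁ ∷ q₂ ∷ []) ⟩
    - (a * (q₁ - p₁) + b * (q₂ - p₂)) ≡⟨ cong -_ bézout ⟩
    - 1ℤ                              ∎)
  N : G
  N = aff R gl (0ℤ , 0ℤ)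
  height : (q₂ - p₂) * p₁ + - (q₁ - p₁) * p₂ ≡ p₁ * q₂ - q₁ * p₂
  height = solve (p₁ ∷ p₂ ∷ q₁ ∷ q₂ ∷ [])
  height' : (q₂ - p₂) * q₁ + - (q₁ - p₁) * q₂ ≡ p₁ * q₂ - q₁ * p₂
  height' = solve (p₁ ∷ p₂ ∷ q₁ ∷ q₂ ∷ [])
  unit-step : a * q₁ + b * q₂ ≡ a * p₁ + b * p₂ + 1ℤ
  unit-step = begin
    a * q₁ + b * q₂                                   ≡⟨ solve (a ∷ b ∷ p₁ ∷ p₂ ∷ q₁ ∷ q₂ ∷ []) ⟩
    a * p₁ + b * p₂ + (a * (q₁ - p₁) + b * (q₂ - p₂)) ≡⟨ cong (λ w → a * p₁ + b * p₂ + w) bézout ⟩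
    a * p₁ + b * p₂ + 1ℤ                              ∎

unit-solves : ∀ {D δ} u q → δ * u - 1ℤ ≡ q * D → ∀ c → ∃₂ λ K v → K * δ + D * v ≡ c
unit-solves {D} {δ} u q δu≡1 c = u * c , - (q * c) , (begin
  u * c * δ + D * - (q * c)             ≡⟨ solve (D ∷ δ ∷ u ∷ q ∷ c ∷ []) ⟩
  c * (δ * u - 1ℤ) - c * (q * D) + c    ≡⟨ cong (λ z → c * z - c * (q * D) + c) δu≡1 ⟩
  c * (q * D) - c * (q * D) + c         ≡⟨ solve (D ∷ q ∷ c ∷ []) ⟩
  c                                     ∎)

signed-congruence : ∀ {D δ δ'} →
  (∃ λ q → δ - δ' ≡ q * D) ⊎ (∃ λ q → δ - - δ' ≡ q * D) →
  ∃ λ s → (s * s ≡ 1ℤ) × (∃ λ v → s * δ + D * v ≡ δ')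
signed-congruence {D} {δ} {δ'} (inj₁ (q , eq)) = 1ℤ , refl , - q , (begin
  1ℤ * δ + D * - q      ≡⟨ solve (D ∷ δ ∷ δ' ∷ q ∷ []) ⟩
  δ - δ' - q * D + δ'   ≡⟨ cong (λ z → z - q * D + δ') eq ⟩
  q * D - q * D + δ'    ≡⟨ solve (D ∷ δ' ∷ q ∷ []) ⟩
  δ'                    ∎)
signed-congruence {D} {δ} {δ'} (inj₂ (q , eq)) = - 1ℤ , refl , q , (begin
  - 1ℤ * δ + D * q       ≡⟨ solve (D ∷ δ ∷ δ' ∷ q ∷ []) ⟩
  q * D - (δ - - δ') + δ' ≡⟨ cong (λ z → q * D - z + δ') eq ⟩
  q * D - q * D + δ'     ≡⟨ solve (D ∷ δ' ∷ q ∷ []) ⟩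
  δ'                     ∎)

shear-move : ∀ d {δ δ' t s v₂} → t * t ≡ 1ℤ → s * s ≡ 1ℤ →
  (∀ c → ∃₂ λ K v → K * δ + + d * v ≡ c) → s * δ + + d * v₂ ≡ δ' →
  ∀ A X → ∃ λ M → (act d M (A , δ) ≡ (X , δ')) × (act d M (A + 1ℤ , δ) ≡ (X + t , δ'))
shear-move d {δ} {δ'} {t} {s} {v₂} tt ss onto sδ≡δ' A X with onto (X - t * A)
... | K , v₁ , shift =
  aff S gl (v₁ , v₂) ,
  cong₂ _,_ (reach A X (solve (t ∷ A ∷ X ∷ []))) (height A) ,
  cong₂ _,_ (reach (A + 1ℤ) (X + t) (solve (t ∷ A ∷ X ∷ []))) (height (A + 1ℤ))
  where
  S : Mat
  S = mat t K 0ℤ s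
  det-S : t * s - K * 0ℤ ≡ t * s
  det-S = solve (t ∷ s ∷ K ∷ [])
  gl : InGL2 S
  gl = unimodular⇒GL S (t * s)
         (trans {j = (t * t) * (s * s)} (solve (t ∷ s ∷ [])) (cong₂ _*_ tt ss))
         det-S
  reach : ∀ B Y → t * B + (X - t * A) ≡ Y → t * B + K * δ + + d * v₁ ≡ Y
  reach B Y eq = begin
    t * B + K * δ + + d * v₁   ≡⟨ +-assoc (t * B) (K * δ) (+ d * v₁) ⟩
    t * B + (K * δ + + d * v₁) ≡⟨ cong (λ w → t * B + w) shift ⟩
    t * B + (X - t * A)        ≡⟨ eq ⟩
    Y                          ∎
  height : ∀ B → 0ℤ * B + s * δ + + d * v₂ ≡ δ'
  height B = begin
    0ℤ * B + s * δ + + d * v₂ ≡⟨ cong (λ z → z + s * δ + + d * v₂) (*-zeroˡ B) ⟩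
    0ℤ + s * δ + + d * v₂     ≡⟨ cong (_+ + d * v₂) (+-identityˡ (s * δ)) ⟩
    s * δ + + d * v₂          ≡⟨ sδ≡δ' ⟩
    δ'                        ∎

StepMoves : ℕ → ℤ → ℤ → Set
StepMoves d δ δ' = ∀ t → t * t ≡ 1ℤ → ∀ A X →
  ∃ λ M → (act d M (A , δ) ≡ (X , δ')) × (act d M (A + 1ℤ , δ) ≡ (X + t , δ'))

step-moves : ∀ d {δ δ'} → UnitMod d δ → CongMod d δ δ' ⊎ CongMod d δ (- δ') →
  StepMoves d δ δ'
step-moves d {δ} {δ'} (u , unit) weights t tt A X
  with quotient-of {d} {δ * u} {1ℤ} unit
     | signed-congruence {+ d} {δ} {δ'} (Sum.map (quotient-of {d} {δ} {δ'}) (quotient-of {d} {δ} { - δ'}) weights)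
... | q , δu≡1 | s , ss , v₂ , sδ≡δ' =
  shear-move d {δ} {δ'} {t} {s} {v₂} tt ss (unit-solves u q δu≡1) sδ≡δ' A X

Preserving Reversing : ℕ → G → Seg → Seg → Set
Preserving d g E F = (act d g (start E) ≡ start F) × (act d g (end E) ≡ end F)
Reversing d g E F = (act d g (start E) ≡ end F) × (act d g (end E) ≡ start F)

preserving-equivalence : ∀ d E F → NormalForm d E → NormalForm d F →
  StepMoves d (det E) (det F) → ∃ λ g → Preserving d g E F
preserving-equivalence d E F (A , Nᴱ , startᴱ , endᴱ) (A' , Nᶠ , startᶠ , endᶠ) moves
  with moves 1ℤ refl A A'
... | M , M₀ , M₁ = inverse Nᶠ ∘ᴳ (M ∘ᴳ Nᴱ) ,
  act-through d Nᴱ M Nᶠ startᴱ (trans M₀ (sym startᶠ)) ,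
  act-through d Nᴱ M Nᶠ endᴱ (trans M₁ (sym endᶠ))

reversing-equivalence : ∀ d E F → NormalForm d E → NormalForm d F →
  StepMoves d (det E) (det F) → ∃ λ g → Reversing d g E F
reversing-equivalence d E F (A , Nᴱ , startᴱ , endᴱ) (A' , Nᶠ , startᶠ , endᶠ) moves
  with moves (- 1ℤ) refl A (A' + 1ℤ)
... | M , M₀ , M₁ = inverse Nᶠ ∘ᴳ (M ∘ᴳ Nᴱ) ,
  act-through d Nᴱ M Nᶠ startᴱ (trans M₀ (sym endᶠ)) ,
  act-through d Nᴱ M Nᶠ endᴱ (trans M₁ (trans (cong (_, det F) back) (sym startᶠ)))
  where
  back : A' + 1ℤ + - 1ℤ ≡ A'
  back = solve (A' ∷ [])

endpoint-matching : ∀ d E F → (∃ λ g → Preserving d g E F) → (∃ λ g → Reversing d g E F) →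
  ∀ p p' → IsEndpoint p E → IsEndpoint p' F → ∃ λ g → MapsOnto d g E F × (act d g p ≡ p')
endpoint-matching d E F (g , g₀ , g₁) (h , h₀ , h₁) _ _ (inj₁ refl) (inj₁ refl) = g , inj₁ (g₀ , g₁) , g₀
endpoint-matching d E F (g , g₀ , g₁) (h , h₀ , h₁) _ _ (inj₂ refl) (inj₂ refl) = g , inj₁ (g₀ , g₁) , g₁
endpoint-matching d E F (g , g₀ , g₁) (h , h₀ , h₁) _ _ (inj₁ refl) (inj₂ refl) = h , inj₂ (h₀ , h₁) , h₀
endpoint-matching d E F (g , g₀ , g₁) (h , h₀ , h₁) _ _ (inj₂ refl) (inj₁ refl) = h , inj₂ (h₀ , h₁) , h₁

lemma4p7 : (d : ℕ) → .{{_ : NonZero d}} → (E F : Seg) →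
    Primitive d E → Primitive d F →
    CongMod d (det E) (det F) ⊎ CongMod d (det E) (- det F) →
    (∃ λ (g : G) → MapsOnto d g E F) ×
    (∀ (p p' : Pt) → IsEndpoint p E → IsEndpoint p' F →
      ∃ λ (g : G) → MapsOnto d g E F × (act d g p ≡ p'))
lemma4p7 d E F (minimalE , unitE) (minimalF , _) weights =
  (proj₁ preserving , inj₁ (proj₂ preserving)) , endpoint-matching d E F preserving reversing
  where
  normalᴱ : NormalForm d E
  normalᴱ = normal-form d E minimalE
  normalᶠ : NormalForm d F
  normalᶠ = normal-form d F minimalF
  moves : StepMoves d (det E) (det F)
  moves = step-moves d unitE weights
  preserving : ∃ λ g → Preserving d g E F
  preserving = preserving-equivalence d E F normalᴱ normalᶠ moves
  reversing : ∃ λ g → Reversing d g E F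
  reversing = reversing-equivalence d E F normalᴱ normalᶠ moves
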